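{- Suppose there is a resolvable $(v,b,r,k,\lambda)$-BIBD with $v/k=4$. Then there is a $3$-$(v,v/2,3\lambda)$-design.
   Context: A $(v,b,r,k,\lambda)$-BIBD is a pair $(X,\mathcal{B})$ with $|X|=v$ and $\mathcal{B}$ a multiset of $b$ subsets of $X$ of size $k$ ($2\le k<v$) such that every point lies in exactly $r$ blocks and every pair of distinct points lies in exactly $\lambda$ blocks. It is resolvable if $k\mid v$ and $\mathcal{B}$ can be partitioned into $r$ classes, each consisting of $v/k$ pairwise disjoint blocks. For $t\le k<v$, a $t$-$(v,k,\lambda)$-design is a pair $(X,\mathcal{B})$ with $|X|=v$ and $\mathcal{B}$ a multiset of $k$-subsets of $X$ such that every $t$-subset of $X$ lies in exactly $\lambda$ blocks. -}

module Defs where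

open import Data.Nat using (ℕ; _≤_; _<_)
open import Data.Fin using (Fin)
open import Data.Fin.Subset using (Subset; ∣_∣; _∈_; _⊆_; _∩_; ⊥)
open import Data.Fin.Subset.Properties using (_∈?_; _⊆?_)
open import Data.List using (length; filter)
open import Data.List.Base using (allFin)
open import Data.Product using (_×_; Σ; ∃)
open import Relation.Binary.PropositionalEquality using (_≡_; _≢_)
open import Relation.Nullary.Decidable using (_×-dec_)
open import Relation.Unary using (Decidable)

count : {n : ℕ} {P : Fin n → Set} → Decidable P → ℕ
count {n} P? = length (filter P? (allFin n))

-- A (v,b,r,k,λ)-BIBD on point set Fin v; the multiset of b blocks is
-- an indexed family Fin b → Subset v (repetitions allowed).
record BIBD (v b r k lam : ℕ) : Set where
  field
    block      : Fin b → Subset v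
    two≤k      : 2 ≤ k
    k<v        : k < v
    block-size : (i : Fin b) → ∣ block i ∣ ≡ k
    replication : (x : Fin v) → count (λ i → x ∈? block i) ≡ r
    balance    : (x y : Fin v) → x ≢ y →
                 count (λ i → (x ∈? block i) ×-dec (y ∈? block i)) ≡ lam

-- We write m for v/k, with v ≡ m * k (this also encodes k ∣ v).
Resolvable : {v b r k lam : ℕ} → BIBD v b r k lam → Set
Resolvable {v} {b} {r} {k} D =
  Σ ℕ λ m → (v ≡ m Data.Nat.* k) ×
  Σ (Fin b → Fin r) λ class →
    ((c : Fin r) → count (λ i → class i Data.Fin.≟ c) ≡ m) ×
    ((i j : Fin b) → i ≢ j → class i ≡ class j →
       (BIBD.block D i ∩ BIBD.block D j) ≡ ⊥)

record TDesign (t v k lam : ℕ) : Set where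
  field
    nblocks    : ℕ
    block      : Fin nblocks → Subset v
    t≤k        : t ≤ k
    k<v        : k < v
    block-size : (i : Fin nblocks) → ∣ block i ∣ ≡ k
    balance    : (T : Subset v) → ∣ T ∣ ≡ t → count (λ i → T ⊆? block i) ≡ lam

module Submission where

-- The blocks of the 3-design are the unions B ∪ B′ of two distinct blocks of the same parallel
-- class; blocks of a class are disjoint, so each union has 2k = v/2 points.  Every point lies in
-- exactly one block of each class, so for three points x, y, z a class of four blocks contributes
-- 3 covering unions if x, y, z share a block, 1 if exactly two of them do, and 0 otherwise: in
-- each case the number of pairs among x, y, z that share a block of the class.  Summing over the
-- classes gives 3λ.
--
-- The count is carried out with the incidence indicators α, β, γ of x, y, z.  For blocks i ≠ j
-- of one class, [x, y, z ∈ Bᵢ ∪ Bⱼ] = (αᵢ + αⱼ)(βᵢ + βⱼ)(γᵢ + γⱼ); summing over the three other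
-- blocks j of the class of i, where Σⱼ αⱼ = 1 − αᵢ, leaves Σᵢ (αᵢβᵢ + αᵢγᵢ + βᵢγᵢ) = 3λ.

open import Defs

open import Data.Nat.Properties
  using ( +-*-semiring; +-identityʳ; *-identityʳ; *-distribʳ-+; *-distribˡ-+; +-mono-≤; +-cancelʳ-≡
        ; n≤1⇒n≡0∨n≡1; 1+n≰n; ≤-reflexive; ≤-trans; n≤1+n; m<m+n; *-cancelʳ-≡)
open import Algebra.Properties.Semiring.Sum +-*-semiring
  using (sum-syntax; sum-cong-≗; sum-replicate-zero; ∑-distrib-+; ∑-comm; *-distribˡ-sum; *-distribʳ-sum)
open import Data.Bool using (true; false; if_then_else_)
open import Data.Empty using (⊥-elim)
open import Data.Fin as Fin using (Fin; zero; suc)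
open import Data.Fin.Properties using (_≟_; _<?_; <-cmp; <⇒≢; suc-injective; 0≢1+n)
open import Data.Fin.Subset using (Subset; inside; outside; ∣_∣; _∈_; _⊆_; _∩_; _∪_; ⊥)
open import Data.Fin.Subset.Properties using (_∈?_; _⊆?_; ∉⊥; x∈p∩q⁺; x∈p∪q⁺; x∈p∪q⁻)
open import Data.List using (List; []; _∷_; _++_; length; filter; tabulate; lookup; concat; allFin)
open import Data.List.Properties using (length-++; filter-++; tabulate-lookup)
open import Data.List.Membership.Propositional using () renaming (_∈_ to _∈ₗ_)
open import Data.List.Membership.Propositional.Properties using (∈-filter⁺; ∈-filter⁻; ∈-allFin; ∈-lookup)
open import Data.List.Relation.Unary.Any using (here; there)
open import Data.List.Relation.Unary.All using ([]; _∷_)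
open import Data.List.Relation.Unary.AllPairs using ([]; _∷_)
open import Data.List.Relation.Unary.Unique.Propositional using (Unique)
open import Data.List.Relation.Unary.Unique.Propositional.Properties using (filter⁺; allFin⁺)
open import Data.Nat using (ℕ; zero; suc; _+_; _*_; _/_; _≤_; _<_; z≤n; s≤s; NonZero; >-nonZero)
open import Data.Nat.DivMod using (m*n/n≡m)
open import Data.Nat.Solver using (module +-*-Solver)
open import Data.Product using (_×_; _,_; proj₂)
open import Data.Vec using ([]; _∷_)
open import Data.Sum using (inj₁; inj₂; [_,_])
open import Function using (_∘_; id; _⇔_; mk⇔; Equivalence)
open import Level using (Level; 0ℓ)
open import Relation.Binary.PropositionalEquality
  using (_≡_; _≢_; refl; sym; trans; cong; cong₂; subst; module ≡-Reasoning)
open import Relation.Binary.Definitions using (tri<; tri≈; tri>)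
open import Relation.Nullary using (Dec; yes; no; does; ¬_; ¬?; contradiction)
open import Relation.Nullary.Decidable using (_×-dec_)
open import Relation.Unary using (Pred; Decidable)

open +-*-Solver using (solve; _:+_; _:*_; _:=_; con)

private variable
  ℓ ℓ′ : Level
  n : ℕ
  A : Set
  P : Set ℓ
  R : Set ℓ′

𝟙 : Dec P → ℕ
𝟙 P? = if does P? then 1 else 0

𝟙-yes : P → (P? : Dec P) → 𝟙 P? ≡ 1
𝟙-yes p (yes _) = refl
𝟙-yes p (no ¬p) = contradiction p ¬p

𝟙-no : ¬ P → (P? : Dec P) → 𝟙 P? ≡ 0
𝟙-no ¬p (yes p) = contradiction p ¬p
𝟙-no ¬p (no _)  = refl

𝟙-cong : (P → R) → (R → P) → (P? : Dec P) (R? : Dec R) → 𝟙 P? ≡ 𝟙 R?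
𝟙-cong to from (yes p) R? = sym (𝟙-yes (to p) R?)
𝟙-cong to from (no ¬p) R? = sym (𝟙-no (¬p ∘ from) R?)

𝟙-× : (P? : Dec P) (R? : Dec R) → 𝟙 (P? ×-dec R?) ≡ 𝟙 P? * 𝟙 R?
𝟙-× (yes _) (yes _) = refl
𝟙-× (yes _) (no _)  = refl
𝟙-× (no _)  _       = refl

𝟙-*-cong : {m n : ℕ} → (P → m ≡ n) → (P? : Dec P) → 𝟙 P? * m ≡ 𝟙 P? * n
𝟙-*-cong m≡n (yes p) = cong (1 *_) (m≡n p)
𝟙-*-cong m≡n (no _)  = refl

𝟙-<-+-> : (i j : Fin n) → 𝟙 (i <? j) + 𝟙 (j <? i) ≡ 𝟙 (¬? (i ≟ j))
𝟙-<-+-> i j with <-cmp i j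
... | tri< i<j i≢j j≮i =
  trans (cong₂ _+_ (𝟙-yes i<j (i <? j)) (𝟙-no j≮i (j <? i))) (sym (𝟙-yes i≢j (¬? (i ≟ j))))
... | tri≈ i≮j i≡j j≮i =
  trans (cong₂ _+_ (𝟙-no i≮j (i <? j)) (𝟙-no j≮i (j <? i))) (sym (𝟙-no (λ i≢j → i≢j i≡j) (¬? (i ≟ j))))
... | tri> i≮j i≢j j<i =
  trans (cong₂ _+_ (𝟙-no i≮j (i <? j)) (𝟙-yes j<i (j <? i))) (sym (𝟙-yes i≢j (¬? (i ≟ j))))

∑-zero : (f : Fin n → ℕ) → (∀ i → f i ≡ 0) → ∑[ i < n ] f i ≡ 0
∑-zero {n} f f≡0 = trans (sum-cong-≗ f≡0) (sum-replicate-zero n)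

∑-δ : (i : Fin n) (f : Fin n → ℕ) → ∑[ j < n ] (𝟙 (i ≟ j) * f j) ≡ f i
∑-δ {suc n} zero f = trans (cong₂ _+_ (+-identityʳ (f zero)) (∑-zero {n} _ (λ _ → refl))) (+-identityʳ (f zero))
∑-δ {suc n} (suc i) f = ∑-δ i (f ∘ suc)

∑≤n : (f : Fin n → ℕ) → (∀ i → f i ≤ 1) → ∑[ i < n ] f i ≤ n
∑≤n {zero} f f≤1 = z≤n
∑≤n {suc n}  f f≤1 = +-mono-≤ (f≤1 zero) (∑≤n (f ∘ suc) (f≤1 ∘ suc))

∑≡n⇒≡1 : (f : Fin n → ℕ) → (∀ i → f i ≤ 1) → ∑[ i < n ] f i ≡ n → ∀ i → f i ≡ 1
∑≡n⇒≡1 {suc n} f f≤1 ∑≡n = all≡1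
  where
  rest = ∑[ i < n ] f (suc i)
  f₀≡1 : f zero ≡ 1
  f₀≡1 with n≤1⇒n≡0∨n≡1 (f≤1 zero)
  ... | inj₁ f₀≡0 =
    ⊥-elim (1+n≰n (subst (_≤ n) (trans (cong (_+ rest) (sym f₀≡0)) ∑≡n) (∑≤n (f ∘ suc) (f≤1 ∘ suc))))
  ... | inj₂ f₀≡1 = f₀≡1
  all≡1 : ∀ i → f i ≡ 1
  all≡1 zero    = f₀≡1
  all≡1 (suc i) =
    ∑≡n⇒≡1 (f ∘ suc) (f≤1 ∘ suc) (Data.Nat.Properties.suc-injective (trans (cong (_+ rest) (sym f₀≡1)) ∑≡n)) i

∑𝟙≤1 : {P : Pred (Fin n) ℓ} (P? : Decidable P) → (∀ {i j} → P i → P j → i ≡ j) →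
       ∑[ i < n ] 𝟙 (P? i) ≤ 1
∑𝟙≤1 {zero} P? unique = z≤n
∑𝟙≤1 {suc n}  P? unique with P? zero
... | yes P₀ = ≤-reflexive (cong suc (∑-zero {n} _ (λ i → 𝟙-no (λ Pᵢ → 0≢1+n (unique P₀ Pᵢ)) (P? (suc i)))))
... | no _   = ∑𝟙≤1 (P? ∘ suc) (λ Pᵢ Pⱼ → suc-injective (unique Pᵢ Pⱼ))

∑∑-distrib-+ : ∀ {m} (f g : Fin m → Fin n → ℕ) →
  ∑[ i < m ] ∑[ j < n ] (f i j + g i j) ≡ ∑[ i < m ] ∑[ j < n ] f i j + ∑[ i < m ] ∑[ j < n ] g i j
∑∑-distrib-+ f g = trans (sum-cong-≗ λ i → ∑-distrib-+ (f i) (g i))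
                         (∑-distrib-+ (λ i → ∑[ j < _ ] f i j) (λ i → ∑[ j < _ ] g i j))

three-pairs-identity : ∀ a b c X Y Z → X + a ≡ 1 → Y + b ≡ 1 → Z + c ≡ 1 →
              a * b * c * 3 + a * b * Z + a * c * Y + b * c * X ≡ a * b + a * c + b * c
three-pairs-identity a b c X Y Z X+a≡1 Y+b≡1 Z+c≡1 = begin
  a * b * c * 3 + a * b * Z + a * c * Y + b * c * X
    ≡⟨ solve 6 (λ a b c X Y Z → a :* b :* c :* con 3 :+ a :* b :* Z :+ a :* c :* Y :+ b :* c :* X
                              := a :* b :* (Z :+ c) :+ a :* c :* (Y :+ b) :+ b :* c :* (X :+ a)) refl a b c X Y Z ⟩
  a * b * (Z + c) + a * c * (Y + b) + b * c * (X + a)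
    ≡⟨ cong₂ _+_ (cong₂ _+_ (cong (a * b *_) Z+c≡1) (cong (a * c *_) Y+b≡1)) (cong (b * c *_) X+a≡1) ⟩
  a * b * 1 + a * c * 1 + b * c * 1
    ≡⟨ cong₂ _+_ (cong₂ _+_ (*-identityʳ (a * b)) (*-identityʳ (a * c))) (*-identityʳ (b * c)) ⟩
  a * b + a * c + b * c ∎
  where open ≡-Reasoning

length-filter-tabulate : {P : Pred A ℓ} (P? : Decidable P) (f : Fin n → A) →
                         length (filter P? (tabulate f)) ≡ ∑[ i < n ] 𝟙 (P? (f i))
length-filter-tabulate {n = zero} P? f = refl
length-filter-tabulate {n = suc n}  P? f with does (P? (f zero))
... | true  = cong suc (length-filter-tabulate P? (f ∘ suc))
... | false = length-filter-tabulate P? (f ∘ suc)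

count≡∑𝟙 : {P : Pred (Fin n) 0ℓ} (P? : Decidable P) → count P? ≡ ∑[ i < n ] 𝟙 (P? i)
count≡∑𝟙 P? = length-filter-tabulate P? id

count-lookup : {P : Pred A 0ℓ} (P? : Decidable P) (xs : List A) →
               count (P? ∘ lookup xs) ≡ length (filter P? xs)
count-lookup P? xs = begin
  count (P? ∘ lookup xs)                       ≡⟨ count≡∑𝟙 (P? ∘ lookup xs) ⟩
  ∑[ i < length xs ] 𝟙 (P? (lookup xs i))      ≡⟨ length-filter-tabulate P? (lookup xs) ⟨
  length (filter P? (tabulate (lookup xs)))    ≡⟨ cong (length ∘ filter P?) (tabulate-lookup xs) ⟩
  length (filter P? xs)                        ∎
  where open ≡-Reasoning

length-filter-filter : {P : Pred A ℓ} {Q : Pred A ℓ′} (P? : Decidable P) (Q? : Decidable Q) (xs : List A) →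
                       length (filter Q? (filter P? xs)) ≡ length (filter (λ x → P? x ×-dec Q? x) xs)
length-filter-filter P? Q? [] = refl
length-filter-filter P? Q? (x ∷ xs) with does (P? x)
... | false = length-filter-filter P? Q? xs
... | true with does (Q? x)
...   | true  = cong suc (length-filter-filter P? Q? xs)
...   | false = length-filter-filter P? Q? xs

length-filter-concat-tabulate : ∀ {m} {P : Pred A ℓ} (P? : Decidable P) (f : Fin m → Fin n → A) →
  length (filter P? (concat (tabulate λ i → tabulate (f i)))) ≡ ∑[ i < m ] ∑[ j < n ] 𝟙 (P? (f i j))
length-filter-concat-tabulate {m = zero} P? f = refl
length-filter-concat-tabulate {m = suc m}  P? f = begin
  length (filter P? (tabulate (f zero) ++ rows))
    ≡⟨ cong length (filter-++ P? (tabulate (f zero)) rows) ⟩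
  length (filter P? (tabulate (f zero)) ++ filter P? rows)
    ≡⟨ length-++ (filter P? (tabulate (f zero))) ⟩
  length (filter P? (tabulate (f zero))) + length (filter P? rows)
    ≡⟨ cong₂ _+_ (length-filter-tabulate P? (f zero)) (length-filter-concat-tabulate P? (f ∘ suc)) ⟩
  ∑[ j < _ ] 𝟙 (P? (f zero j)) + ∑[ i < m ] ∑[ j < _ ] 𝟙 (P? (f (suc i) j)) ∎
  where
  open ≡-Reasoning
  rows = concat (tabulate λ i → tabulate (f (suc i)))

finPairs : (m n : ℕ) → List (Fin m × Fin n)
finPairs m n = concat (tabulate λ i → tabulate (i ,_))

∣p∣≡∑𝟙∈ : (p : Subset n) → ∣ p ∣ ≡ ∑[ x < n ] 𝟙 (x ∈? p)
∣p∣≡∑𝟙∈ []            = refl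
∣p∣≡∑𝟙∈ (inside  ∷ p) = cong suc (∣p∣≡∑𝟙∈ p)
∣p∣≡∑𝟙∈ (outside ∷ p) = ∣p∣≡∑𝟙∈ p

𝟙∈∪ : (x : Fin n) {p q : Subset n} → p ∩ q ≡ ⊥ → 𝟙 (x ∈? p ∪ q) ≡ 𝟙 (x ∈? p) + 𝟙 (x ∈? q)
𝟙∈∪ x {p} {q} p∩q≡⊥ with x ∈? p | x ∈? q
... | yes x∈p | yes x∈q = ⊥-elim (∉⊥ (subst (x ∈_) p∩q≡⊥ (x∈p∩q⁺ (x∈p , x∈q))))
... | yes x∈p | no  _   = 𝟙-yes (x∈p∪q⁺ (inj₁ x∈p)) (x ∈? p ∪ q)
... | no  _   | yes x∈q = 𝟙-yes (x∈p∪q⁺ (inj₂ x∈q)) (x ∈? p ∪ q)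
... | no  x∉p | no  x∉q = 𝟙-no ([ x∉p , x∉q ] ∘ x∈p∪q⁻ p q) (x ∈? p ∪ q)

∣p∪q∣≡∣p∣+∣q∣ : {p q : Subset n} → p ∩ q ≡ ⊥ → ∣ p ∪ q ∣ ≡ ∣ p ∣ + ∣ q ∣
∣p∪q∣≡∣p∣+∣q∣ {n} {p} {q} p∩q≡⊥ = begin
  ∣ p ∪ q ∣                                        ≡⟨ ∣p∣≡∑𝟙∈ (p ∪ q) ⟩
  ∑[ x < n ] 𝟙 (x ∈? p ∪ q)                        ≡⟨ sum-cong-≗ (λ x → 𝟙∈∪ x p∩q≡⊥) ⟩
  ∑[ x < n ] (𝟙 (x ∈? p) + 𝟙 (x ∈? q))             ≡⟨ ∑-distrib-+ (λ x → 𝟙 (x ∈? p)) (λ x → 𝟙 (x ∈? q)) ⟩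
  ∑[ x < n ] 𝟙 (x ∈? p) + ∑[ x < n ] 𝟙 (x ∈? q)    ≡⟨ cong₂ _+_ (∣p∣≡∑𝟙∈ p) (∣p∣≡∑𝟙∈ q) ⟨
  ∣ p ∣ + ∣ q ∣                                    ∎
  where open ≡-Reasoning

record ThreeElements (T : Subset n) : Set where
  field
    x y z : Fin n
    x≢y   : x ≢ y
    x≢z   : x ≢ z
    y≢z   : y ≢ z
    ⊆⇔∈   : ∀ S → T ⊆ S ⇔ (x ∈ S × y ∈ S × z ∈ S)

∣T∣≡3⇒threeElements : (T : Subset n) → ∣ T ∣ ≡ 3 → ThreeElements T
∣T∣≡3⇒threeElements {n} T ∣T∣≡3 =
  fromList members (trans (length-filter-tabulate (_∈? T) id) (trans (sym (∣p∣≡∑𝟙∈ T)) ∣T∣≡3))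
    (filter⁺ (_∈? T) (allFin⁺ n))
    (λ w∈T → ∈-filter⁺ (_∈? T) (∈-allFin _) w∈T)
    (λ w∈members → proj₂ (∈-filter⁻ (_∈? T) {xs = allFin n} w∈members))
  where
  members = filter (_∈? T) (allFin n)
  fromList : (xs : List (Fin n)) → length xs ≡ 3 → Unique xs →
             (∀ {w} → w ∈ T → w ∈ₗ xs) → (∀ {w} → w ∈ₗ xs → w ∈ T) → ThreeElements T
  fromList (x ∷ y ∷ z ∷ []) refl ((x≢y ∷ x≢z ∷ []) ∷ (y≢z ∷ []) ∷ [] ∷ []) into from = record
    { x = x ; y = y ; z = z ; x≢y = x≢y ; x≢z = x≢z ; y≢z = y≢z
    ; ⊆⇔∈ = λ S → mk⇔
        (λ T⊆S → T⊆S (from (here refl)) , T⊆S (from (there (here refl))) , T⊆S (from (there (there (here refl)))))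
        (λ (x∈S , y∈S , z∈S) w∈T → elim x∈S y∈S z∈S (into w∈T))
    }
    where
    elim : ∀ {S w} → x ∈ S → y ∈ S → z ∈ S → w ∈ₗ (x ∷ y ∷ z ∷ []) → w ∈ S
    elim x∈S _ _ (here refl)                 = x∈S
    elim _ y∈S _ (there (here refl))         = y∈S
    elim _ _ z∈S (there (there (here refl))) = z∈S

module Resolution {v b r k lam m : ℕ} (D : BIBD v b r k lam) (v≡m*k : v ≡ m * k)
  (class : Fin b → Fin r)
  (class-size : ∀ c → count (λ i → class i ≟ c) ≡ m)
  (class-disjoint : ∀ i j → i ≢ j → class i ≡ class j → BIBD.block D i ∩ BIBD.block D j ≡ ⊥)
  where

  open BIBD D

  χ : Fin v → Fin b → ℕ
  χ x i = 𝟙 (x ∈? block i)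

  ∑-χ : ∀ i → ∑[ x < v ] χ x i ≡ k
  ∑-χ i = trans (sym (∣p∣≡∑𝟙∈ (block i))) (block-size i)

  ∑-class-χ≤1 : ∀ c x → ∑[ j < b ] (𝟙 (class j ≟ c) * χ x j) ≤ 1
  ∑-class-χ≤1 c x = subst (_≤ 1) (sum-cong-≗ λ j → 𝟙-× (class j ≟ c) (x ∈? block j))
                                   (∑𝟙≤1 (λ j → (class j ≟ c) ×-dec (x ∈? block j)) unique)
    where
    unique : ∀ {i j} → class i ≡ c × x ∈ block i → class j ≡ c × x ∈ block j → i ≡ j
    unique {i} {j} (cᵢ , x∈i) (cⱼ , x∈j) with i ≟ j
    ... | yes i≡j = i≡j
    ... | no  i≢j =
      ⊥-elim (∉⊥ (subst (x ∈_) (class-disjoint i j i≢j (trans cᵢ (sym cⱼ))) (x∈p∩q⁺ (x∈i , x∈j))))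

  ∑∑-class-χ : ∀ c → ∑[ x < v ] ∑[ j < b ] (𝟙 (class j ≟ c) * χ x j) ≡ v
  ∑∑-class-χ c = begin
    ∑[ x < v ] ∑[ j < b ] (𝟙 (class j ≟ c) * χ x j)  ≡⟨ ∑-comm (λ x j → 𝟙 (class j ≟ c) * χ x j) ⟩
    ∑[ j < b ] ∑[ x < v ] (𝟙 (class j ≟ c) * χ x j)  ≡⟨ sum-cong-≗ (λ j → *-distribˡ-sum (𝟙 (class j ≟ c)) (λ x → χ x j)) ⟨
    ∑[ j < b ] (𝟙 (class j ≟ c) * ∑[ x < v ] χ x j)  ≡⟨ sum-cong-≗ (λ j → cong (𝟙 (class j ≟ c) *_) (∑-χ j)) ⟩
    ∑[ j < b ] (𝟙 (class j ≟ c) * k)                 ≡⟨ *-distribʳ-sum k (λ j → 𝟙 (class j ≟ c)) ⟨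
    ∑[ j < b ] 𝟙 (class j ≟ c) * k                   ≡⟨ cong (_* k) (trans (sym (count≡∑𝟙 (λ j → class j ≟ c))) (class-size c)) ⟩
    m * k                                            ≡⟨ v≡m*k ⟨
    v                                                ∎
    where open ≡-Reasoning

  ∑-class-χ≡1 : ∀ c x → ∑[ j < b ] (𝟙 (class j ≟ c) * χ x j) ≡ 1
  ∑-class-χ≡1 c = ∑≡n⇒≡1 _ (∑-class-χ≤1 c) (∑∑-class-χ c)

  ∑χχ≡λ : ∀ {x y} → x ≢ y → ∑[ i < b ] (χ x i * χ y i) ≡ lam
  ∑χχ≡λ {x} {y} x≢y = begin
    ∑[ i < b ] (χ x i * χ y i)                          ≡⟨ sum-cong-≗ (λ i → 𝟙-× (x ∈? block i) (y ∈? block i)) ⟨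
    ∑[ i < b ] 𝟙 ((x ∈? block i) ×-dec (y ∈? block i))  ≡⟨ count≡∑𝟙 (λ i → (x ∈? block i) ×-dec (y ∈? block i)) ⟨
    count (λ i → (x ∈? block i) ×-dec (y ∈? block i))   ≡⟨ balance x y x≢y ⟩
    lam                                                 ∎
    where open ≡-Reasoning

  Other : Fin b → Fin b → Set
  Other i j = i ≢ j × class j ≡ class i

  other? : ∀ i j → Dec (Other i j)
  other? i j = ¬? (i ≟ j) ×-dec (class j ≟ class i)

  𝟙-sameClass : ∀ i j → 𝟙 (class j ≟ class i) ≡ 𝟙 (other? i j) + 𝟙 (i ≟ j)
  𝟙-sameClass i j with i ≟ j
  ... | yes refl = 𝟙-yes refl (class i ≟ class i)
  ... | no  _    = sym (+-identityʳ _)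

  sumOthers : Fin b → (Fin b → ℕ) → ℕ
  sumOthers i f = ∑[ j < b ] (𝟙 (other? i j) * f j)

  sumOthers-+ : ∀ i (f g : Fin b → ℕ) → sumOthers i (λ j → f j + g j) ≡ sumOthers i f + sumOthers i g
  sumOthers-+ i f g = trans (sum-cong-≗ λ j → *-distribˡ-+ (𝟙 (other? i j)) (f j) (g j))
                            (∑-distrib-+ (λ j → 𝟙 (other? i j) * f j) (λ j → 𝟙 (other? i j) * g j))

  sumOthers-* : ∀ i c (f : Fin b → ℕ) → sumOthers i (λ j → c * f j) ≡ c * sumOthers i f
  sumOthers-* i c f = trans (sum-cong-≗ λ j → *-comm-middle (𝟙 (other? i j)) c (f j))
                            (sym (*-distribˡ-sum c (λ j → 𝟙 (other? i j) * f j)))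
    where
    *-comm-middle : ∀ a b c → a * (b * c) ≡ b * (a * c)
    *-comm-middle = solve 3 (λ a b c → a :* (b :* c) := b :* (a :* c)) refl

  sumSameClass≡sumOthers+ : ∀ i (f : Fin b → ℕ) →
                            ∑[ j < b ] (𝟙 (class j ≟ class i) * f j) ≡ sumOthers i f + f i
  sumSameClass≡sumOthers+ i f = begin
    ∑[ j < b ] (𝟙 (class j ≟ class i) * f j)
      ≡⟨ sum-cong-≗ (λ j → trans (cong (_* f j) (𝟙-sameClass i j))
                                 (*-distribʳ-+ (f j) (𝟙 (other? i j)) (𝟙 (i ≟ j)))) ⟩
    ∑[ j < b ] (𝟙 (other? i j) * f j + 𝟙 (i ≟ j) * f j)
      ≡⟨ ∑-distrib-+ (λ j → 𝟙 (other? i j) * f j) (λ j → 𝟙 (i ≟ j) * f j) ⟩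
    sumOthers i f + ∑[ j < b ] (𝟙 (i ≟ j) * f j)
      ≡⟨ cong (sumOthers i f +_) (∑-δ i f) ⟩
    sumOthers i f + f i ∎
    where open ≡-Reasoning

  sumOthers-χ : ∀ i x → sumOthers i (χ x) + χ x i ≡ 1
  sumOthers-χ i x = trans (sym (sumSameClass≡sumOthers+ i (χ x))) (∑-class-χ≡1 (class i) x)

  sumOthers-1 : ∀ i → sumOthers i (λ _ → 1) + 1 ≡ m
  sumOthers-1 i = begin
    sumOthers i (λ _ → 1) + 1                ≡⟨ sumSameClass≡sumOthers+ i (λ _ → 1) ⟨
    ∑[ j < b ] (𝟙 (class j ≟ class i) * 1)   ≡⟨ sum-cong-≗ (λ j → *-identityʳ (𝟙 (class j ≟ class i))) ⟩
    ∑[ j < b ] 𝟙 (class j ≟ class i)         ≡⟨ count≡∑𝟙 (λ j → class j ≟ class i) ⟨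
    count (λ j → class j ≟ class i)          ≡⟨ class-size (class i) ⟩
    m                                        ∎
    where open ≡-Reasoning

  SameClassPair : Fin b × Fin b → Set
  SameClassPair (i , j) = i Fin.< j × class j ≡ class i

  sameClassPair? : Decidable SameClassPair
  sameClassPair? (i , j) = (i <? j) ×-dec (class j ≟ class i)

  𝟙-sameClassPair-sym : ∀ i j → 𝟙 (sameClassPair? (i , j)) + 𝟙 (sameClassPair? (j , i)) ≡ 𝟙 (other? i j)
  𝟙-sameClassPair-sym i j = begin
    𝟙 (sameClassPair? (i , j)) + 𝟙 (sameClassPair? (j , i))
      ≡⟨ cong₂ _+_ (𝟙-× (i <? j) (class j ≟ class i))
                   (trans (𝟙-× (j <? i) (class i ≟ class j))
                          (cong (𝟙 (j <? i) *_) (𝟙-cong sym sym (class i ≟ class j) (class j ≟ class i)))) ⟩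
    𝟙 (i <? j) * same + 𝟙 (j <? i) * same  ≡⟨ *-distribʳ-+ same (𝟙 (i <? j)) (𝟙 (j <? i)) ⟨
    (𝟙 (i <? j) + 𝟙 (j <? i)) * same      ≡⟨ cong (_* same) (𝟙-<-+-> i j) ⟩
    𝟙 (¬? (i ≟ j)) * same                  ≡⟨ 𝟙-× (¬? (i ≟ j)) (class j ≟ class i) ⟨
    𝟙 (other? i j)                         ∎
    where
    open ≡-Reasoning
    same = 𝟙 (class j ≟ class i)

  ∑∑-sameClassPair-sym : (f : Fin b → Fin b → ℕ) →
    ∑[ i < b ] ∑[ j < b ] (𝟙 (sameClassPair? (i , j)) * (f i j + f j i)) ≡ ∑[ i < b ] sumOthers i (f i)
  ∑∑-sameClassPair-sym f = begin
    ∑[ i < b ] ∑[ j < b ] (s i j * (f i j + f j i))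
      ≡⟨ sum-cong-≗ (λ i → sum-cong-≗ λ j → *-distribˡ-+ (s i j) (f i j) (f j i)) ⟩
    ∑[ i < b ] ∑[ j < b ] (s i j * f i j + s i j * f j i)
      ≡⟨ ∑∑-distrib-+ (λ i j → s i j * f i j) (λ i j → s i j * f j i) ⟩
    ∑[ i < b ] ∑[ j < b ] (s i j * f i j) + ∑[ i < b ] ∑[ j < b ] (s i j * f j i)
      ≡⟨ cong (∑[ i < b ] ∑[ j < b ] (s i j * f i j) +_) (∑-comm (λ i j → s i j * f j i)) ⟩
    ∑[ i < b ] ∑[ j < b ] (s i j * f i j) + ∑[ i < b ] ∑[ j < b ] (s j i * f i j)
      ≡⟨ ∑∑-distrib-+ (λ i j → s i j * f i j) (λ i j → s j i * f i j) ⟨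
    ∑[ i < b ] ∑[ j < b ] (s i j * f i j + s j i * f i j)
      ≡⟨ sum-cong-≗ (λ i → sum-cong-≗ λ j →
           trans (sym (*-distribʳ-+ (f i j) (s i j) (s j i))) (cong (_* f i j) (𝟙-sameClassPair-sym i j))) ⟩
    ∑[ i < b ] sumOthers i (f i) ∎
    where
    open ≡-Reasoning
    s : Fin b → Fin b → ℕ
    s i j = 𝟙 (sameClassPair? (i , j))

  pairs : List (Fin b × Fin b)
  pairs = filter sameClassPair? (finPairs b b)

  unionOf : Fin b × Fin b → Subset v
  unionOf (i , j) = block i ∪ block j

  pairUnion : Fin (length pairs) → Subset v
  pairUnion = unionOf ∘ lookup pairs

  ∣unionOf∣ : ∀ {p} → SameClassPair p → ∣ unionOf p ∣ ≡ k + k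
  ∣unionOf∣ {i , j} (i<j , cⱼ≡cᵢ) =
    trans (∣p∪q∣≡∣p∣+∣q∣ (class-disjoint i j (<⇒≢ i<j) (sym cⱼ≡cᵢ))) (cong₂ _+_ (block-size i) (block-size j))

  ∣pairUnion∣ : ∀ n → ∣ pairUnion n ∣ ≡ k + k
  ∣pairUnion∣ n = ∣unionOf∣ (proj₂ (∈-filter⁻ sameClassPair? {xs = finPairs b b} (∈-lookup {xs = pairs} n)))

  count-pairUnion⊇ : (T : Subset v) → count (λ n → T ⊆? pairUnion n) ≡
                     ∑[ i < b ] ∑[ j < b ] (𝟙 (sameClassPair? (i , j)) * 𝟙 (T ⊆? block i ∪ block j))
  count-pairUnion⊇ T = begin
    count (λ n → T ⊆? pairUnion n)
      ≡⟨ count-lookup (λ p → T ⊆? unionOf p) pairs ⟩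
    length (filter (λ p → T ⊆? unionOf p) pairs)
      ≡⟨ length-filter-filter sameClassPair? (λ p → T ⊆? unionOf p) (finPairs b b) ⟩
    length (filter (λ p → sameClassPair? p ×-dec (T ⊆? unionOf p)) (finPairs b b))
      ≡⟨ length-filter-concat-tabulate (λ p → sameClassPair? p ×-dec (T ⊆? unionOf p)) _,_ ⟩
    ∑[ i < b ] ∑[ j < b ] 𝟙 (sameClassPair? (i , j) ×-dec (T ⊆? block i ∪ block j))
      ≡⟨ sum-cong-≗ (λ i → sum-cong-≗ λ j → 𝟙-× (sameClassPair? (i , j)) (T ⊆? block i ∪ block j)) ⟩
    ∑[ i < b ] ∑[ j < b ] (𝟙 (sameClassPair? (i , j)) * 𝟙 (T ⊆? block i ∪ block j)) ∎
    where open ≡-Reasoning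

  module Covering {T : Subset v} (three : ThreeElements T) where
    open ThreeElements three

    α β γ : Fin b → ℕ
    α = χ x
    β = χ y
    γ = χ z

    -- The terms of (α i + α j) (β i + β j) (γ i + γ j) with at least two factors indexed by i.
    Q : Fin b → Fin b → ℕ
    Q i j = α i * β i * γ i * 1 + α i * β i * γ j + α i * γ i * β j + β i * γ i * α j

    𝟙-T⊆ : ∀ S → 𝟙 (T ⊆? S) ≡ 𝟙 (x ∈? S) * (𝟙 (y ∈? S) * 𝟙 (z ∈? S))
    𝟙-T⊆ S = begin
      𝟙 (T ⊆? S)                                         ≡⟨ 𝟙-cong to from (T ⊆? S) ((x ∈? S) ×-dec (y ∈? S) ×-dec (z ∈? S)) ⟩
      𝟙 ((x ∈? S) ×-dec (y ∈? S) ×-dec (z ∈? S))         ≡⟨ 𝟙-× (x ∈? S) ((y ∈? S) ×-dec (z ∈? S)) ⟩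
      𝟙 (x ∈? S) * 𝟙 ((y ∈? S) ×-dec (z ∈? S))           ≡⟨ cong (𝟙 (x ∈? S) *_) (𝟙-× (y ∈? S) (z ∈? S)) ⟩
      𝟙 (x ∈? S) * (𝟙 (y ∈? S) * 𝟙 (z ∈? S))             ∎
      where
      open ≡-Reasoning
      open Equivalence (⊆⇔∈ S)

    covers : ∀ i j → Other i j → 𝟙 (T ⊆? block i ∪ block j) ≡ Q i j + Q j i
    covers i j (i≢j , cⱼ≡cᵢ) = begin
      𝟙 (T ⊆? block i ∪ block j)
        ≡⟨ 𝟙-T⊆ (block i ∪ block j) ⟩
      𝟙 (x ∈? block i ∪ block j) * (𝟙 (y ∈? block i ∪ block j) * 𝟙 (z ∈? block i ∪ block j))
        ≡⟨ cong₂ _*_ (𝟙∈∪ x disjoint) (cong₂ _*_ (𝟙∈∪ y disjoint) (𝟙∈∪ z disjoint)) ⟩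
      (α i + α j) * ((β i + β j) * (γ i + γ j))
        ≡⟨ solve 6 (λ aᵢ aⱼ bᵢ bⱼ cᵢ cⱼ → (aᵢ :+ aⱼ) :* ((bᵢ :+ bⱼ) :* (cᵢ :+ cⱼ))
             := (aᵢ :* bᵢ :* cᵢ :* con 1 :+ aᵢ :* bᵢ :* cⱼ :+ aᵢ :* cᵢ :* bⱼ :+ bᵢ :* cᵢ :* aⱼ)
             :+ (aⱼ :* bⱼ :* cⱼ :* con 1 :+ aⱼ :* bⱼ :* cᵢ :+ aⱼ :* cⱼ :* bᵢ :+ bⱼ :* cⱼ :* aᵢ))
             refl (α i) (α j) (β i) (β j) (γ i) (γ j) ⟩
      Q i j + Q j i ∎
      where
      open ≡-Reasoning
      disjoint = class-disjoint i j i≢j (sym cⱼ≡cᵢ)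

    -- The only use of m = 4: every block has exactly three other blocks in its class.
    sumOthers-Q : m ≡ 4 → ∀ i → sumOthers i (Q i) ≡ α i * β i + α i * γ i + β i * γ i
    sumOthers-Q m≡4 i = begin
      sumOthers i (λ j → αβγ * 1 + αβ * γ j + αγ * β j + βγ * α j)
        ≡⟨ sumOthers-+ i (λ j → αβγ * 1 + αβ * γ j + αγ * β j) (λ j → βγ * α j) ⟩
      sumOthers i (λ j → αβγ * 1 + αβ * γ j + αγ * β j) + sumOthers i (λ j → βγ * α j)
        ≡⟨ cong (_+ sumOthers i (λ j → βγ * α j)) (sumOthers-+ i (λ j → αβγ * 1 + αβ * γ j) (λ j → αγ * β j)) ⟩
      sumOthers i (λ j → αβγ * 1 + αβ * γ j) + sumOthers i (λ j → αγ * β j) + sumOthers i (λ j → βγ * α j)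
        ≡⟨ cong (λ s → s + sumOthers i (λ j → αγ * β j) + sumOthers i (λ j → βγ * α j))
                (sumOthers-+ i (λ _ → αβγ * 1) (λ j → αβ * γ j)) ⟩
      sumOthers i (λ _ → αβγ * 1) + sumOthers i (λ j → αβ * γ j) + sumOthers i (λ j → αγ * β j) + sumOthers i (λ j → βγ * α j)
        ≡⟨ cong₂ _+_ (cong₂ _+_ (cong₂ _+_ (sumOthers-* i αβγ (λ _ → 1)) (sumOthers-* i αβ γ)) (sumOthers-* i αγ β))
                     (sumOthers-* i βγ α) ⟩
      αβγ * sumOthers i (λ _ → 1) + αβ * sumOthers i γ + αγ * sumOthers i β + βγ * sumOthers i α
        ≡⟨ cong (λ s → αβγ * s + αβ * sumOthers i γ + αγ * sumOthers i β + βγ * sumOthers i α)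
                (+-cancelʳ-≡ 1 (sumOthers i (λ _ → 1)) 3 (trans (sumOthers-1 i) m≡4)) ⟩
      αβγ * 3 + αβ * sumOthers i γ + αγ * sumOthers i β + βγ * sumOthers i α
        ≡⟨ three-pairs-identity (α i) (β i) (γ i) (sumOthers i α) (sumOthers i β) (sumOthers i γ)
                       (sumOthers-χ i x) (sumOthers-χ i y) (sumOthers-χ i z) ⟩
      αβ + αγ + βγ ∎
      where
      open ≡-Reasoning
      αβγ = α i * β i * γ i
      αβ  = α i * β i
      αγ  = α i * γ i
      βγ  = β i * γ i

    count-covering : m ≡ 4 → count (λ n → T ⊆? pairUnion n) ≡ 3 * lam
    count-covering m≡4 = begin
      count (λ n → T ⊆? pairUnion n)
        ≡⟨ count-pairUnion⊇ T ⟩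
      ∑[ i < b ] ∑[ j < b ] (𝟙 (sameClassPair? (i , j)) * 𝟙 (T ⊆? block i ∪ block j))
        ≡⟨ sum-cong-≗ (λ i → sum-cong-≗ λ j →
             𝟙-*-cong (λ (i<j , cⱼ≡cᵢ) → covers i j (<⇒≢ i<j , cⱼ≡cᵢ)) (sameClassPair? (i , j))) ⟩
      ∑[ i < b ] ∑[ j < b ] (𝟙 (sameClassPair? (i , j)) * (Q i j + Q j i))
        ≡⟨ ∑∑-sameClassPair-sym Q ⟩
      ∑[ i < b ] sumOthers i (Q i)
        ≡⟨ sum-cong-≗ (sumOthers-Q m≡4) ⟩
      ∑[ i < b ] (α i * β i + α i * γ i + β i * γ i)
        ≡⟨ trans (∑-distrib-+ (λ i → α i * β i + α i * γ i) (λ i → β i * γ i))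
                 (cong (_+ ∑[ i < b ] (β i * γ i)) (∑-distrib-+ (λ i → α i * β i) (λ i → α i * γ i))) ⟩
      ∑[ i < b ] (α i * β i) + ∑[ i < b ] (α i * γ i) + ∑[ i < b ] (β i * γ i)
        ≡⟨ cong₂ _+_ (cong₂ _+_ (∑χχ≡λ x≢y) (∑χχ≡λ x≢z)) (∑χχ≡λ y≢z) ⟩
      lam + lam + lam
        ≡⟨ solve 1 (λ l → l :+ l :+ l := con 3 :* l) refl lam ⟩
      3 * lam ∎
      where open ≡-Reasoning

  pairUnionDesign : m ≡ 4 → TDesign 3 v (k + k) (3 * lam)
  pairUnionDesign m≡4 = record
    { nblocks    = length pairs
    ; block      = pairUnion
    ; t≤k        = ≤-trans (n≤1+n 3) 4≤k+k
    ; k<v        = subst (k + k <_) (sym v≡k+k+k+k) (m<m+n (k + k) (≤-trans (s≤s z≤n) 4≤k+k))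
    ; block-size = ∣pairUnion∣
    ; balance    = λ T ∣T∣≡3 → Covering.count-covering (∣T∣≡3⇒threeElements T ∣T∣≡3) m≡4
    }
    where
    4≤k+k : 4 ≤ k + k
    4≤k+k = +-mono-≤ two≤k two≤k
    v≡k+k+k+k : v ≡ (k + k) + (k + k)
    v≡k+k+k+k = trans v≡m*k (trans (cong (_* k) m≡4) (solve 1 (λ k → con 4 :* k := (k :+ k) :+ (k :+ k)) refl k))

corollary2p7 : (v b r k lam : ℕ) (D : BIBD v b r k lam) → Resolvable D →
               v ≡ 4 * k → TDesign 3 v (v / 2) (3 * lam)
corollary2p7 v b r k lam D (m , v≡m*k , class , class-size , class-disjoint) v≡4*k =
  subst (λ s → TDesign 3 v s (3 * lam)) (sym v/2≡k+k) (pairUnionDesign m≡4)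
  where
  open Resolution D v≡m*k class class-size class-disjoint
  instance
    k≢0 : NonZero k
    k≢0 = >-nonZero (≤-trans (s≤s z≤n) (BIBD.two≤k D))
  m≡4 : m ≡ 4
  m≡4 = *-cancelʳ-≡ m 4 k (trans (sym v≡m*k) v≡4*k)
  v/2≡k+k : v / 2 ≡ k + k
  v/2≡k+k = trans (cong (_/ 2) (trans v≡4*k (solve 1 (λ k → con 4 :* k := (k :+ k) :* con 2) refl k)))
                  (m*n/n≡m (k + k) 2)
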